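{- Fix a finite set of processes $\mathcal{P}$ and a finite set of message labels $\mathcal{C}$. Let $\mathsf{LC}$ be the class of all MSGs $G$ (over $\mathcal{P},\mathcal{C}$) for which there exists a local-choice MSG $G'$ with $\mathcal{L}(G)=\mathcal{L}(G')$, and let $\mathsf{CC}$ be the class of all MSGs $G$ for which there exists a controllable-choice MSG $G'$ with $\mathcal{L}(G)=\mathcal{L}(G')$. Then $\mathsf{LC}$ is a proper subset of $\mathsf{CC}$, i.e. $\mathsf{LC}\subseteq\mathsf{CC}$ and $\mathsf{CC}\setminus\mathsf{LC}\neq\emptyset$.
   Context: A basic Message Sequence Chart (bMSC) is a tuple $M=(E,<,\mathcal{P},\mathcal{T},P,\mathcal{M},l)$ where $E$ is a finite set of events, $\mathcal{T}:E\to\{\mathrm{send},\mathrm{receive}\}$, $P:E\to\mathcal{P}$ assigns each event a process, $\mathcal{M}:\mathcal{T}^{ -1}(\mathrm{send})\to\mathcal{T}^{ -1}(\mathrm{receive})$ is a bijection with $P(e)\neq P(\mathcal{M}(e))$ (a pair $(e,\mathcal{M}(e))$ is a message), $l$ assigns each message a label in $\mathcal{C}$, and the visual order $<$ is the reflexive-transitive closure of $\mathcal{M}\cup\bigcup_{p}<_p$ where $<_p$ is a total order on $P^{ -1}(p)$; $<$ is required to be a partial order, and the bMSC must be FIFO: for messages $(e,f),(e',f')$, if $e<_p e'$ and $P(f)=P(f')=p'$ then $f<_{p'}f'$. Events are written as letters of $\Sigma=\{p!q(m)\}\cup\{q?p(m)\}$ ($p!q(m)$: $p$ sends label $m$ to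 $q$; $q?p(m)$: $q$ receives label $m$ from $p$). A linearization of $M$ is a word over $\Sigma$ listing all events of $M$ in a total order consistent with $<$; $\mathcal{L}(M)$ is the set of linearizations. The (weak) sequential composition $M_1\cdot M_2$ of bMSCs with disjoint event sets is the union of the two bMSCs with order the transitive closure of $<_1\cup<_2\cup\bigcup_p (P_1^{ -1}(p)\times P_2^{ -1}(p))$. A Message Sequence Graph (MSG) is $G=(\mathcal{S},\tau,s_0,s_f,L)$ with finite state set $\mathcal{S}$, edge relation $\tau\subseteq\mathcal{S}\times\mathcal{S}$, initial state $s_0$ with no incoming edges, terminal state $s_f$ with no outgoing edges, every node reachable from $s_0$ and $s_f$ reachable from every node, and $L$ labeling each node by a bMSC. A path is $s_1\dots s_k$ with $(s_i,s_{i+1})\in\tau$; a run is a path from $s_0$ to $s_f$; $L(s_1\dots s_k)=L(s_1)\cdot\ldots\cdot L(s_k)$; $\mathcal{L}(G)=\bigcup_{\sigma\text{ run}}\mathcal{L}(L(\sigma))$. A process $p$ initiates a bMSC $M$ if some event $e$ of $M$ with $P(e)=p$ has no event $e'\neq e$ of $M$ with $e'<e$. For a node $s$, $\mathrm{triggers}(s)$ is the set of processes $p$ such that there is a (nonempty) path $\sigma=\sigma_1\dots\sigma_n$ with $(s,\sigma_1)\in\tau$ and $p$ initiates $L(\sigma)$. A choice node is a node with more than one outgoing edge. A choice node $u$ is local-choice iff $\mathrm{triggers}(u)$ is a singleton; an MSG is local-choice iff all its choice nodes are local-choice. For a bMSC $M$ and $P'\subseteq\mathcal{P}$, a send event $e$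 of $M$ is a resolving event for $P'$ iff for every $p\in P'$ there is an event $e_p$ of $M$ on process $p$ with $e<e_p$ (visual order). A choice node $u$ is controllable-choice iff (i) for every path $\sigma$ from $s_0$ to $u$, $L(\sigma)$ contains a resolving event for $\mathrm{triggers}(u)$, and (ii) for every path $\sigma=s_1s_2\dots u$ with $(u,s_1)\in\tau$, $L(\sigma)$ contains a resolving event for $\mathrm{triggers}(u)$. An MSG is controllable-choice iff each of its choice nodes is local-choice or controllable-choice. -}

module Defs where

open import Level using (0ℓ)
open import Data.Nat using (ℕ)
open import Data.Fin using (Fin)
open import Data.Fin.Properties using ()
open import Data.Empty using (⊥)
open import Data.Sum using (_⊎_; inj₁; inj₂; [_,_]′)
open import Data.Sum.Base using (map)
open import Data.Product using (Σ; ∃; ∃-syntax; _×_; _,_; proj₁)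
open import Data.List using (List; length; lookup)
open import Function.Bundles using (_↔_; Inverse)
open import Relation.Nullary using (¬_)
open import Relation.Binary.PropositionalEquality using (_≡_; _≢_)
open import Relation.Binary.Construct.Closure.ReflexiveTransitive using (Star)
import Data.Fin as F

module MSCTheory (Proc Label : Set) where

  data Kind : Set where
    send receive : Kind

  -- the alphabet Σ:  snd p q m  is  p!q(m),   rcv q p m  is  q?p(m)
  data Letter : Set where
    snd : Proc → Proc → Label → Letter
    rcv : Proc → Proc → Label → Letter

  -- The bijection 𝓜 between send and receive events
  -- is encoded by an involution `partner` swapping sends and receives;
  -- the label l of a message is stored on both of its events.
  -- `loc e e'` is the union over p of the strict local total orders <_p.
  record MSC : Set₁ where
    field
      E       : Set
      typ     : E → Kind
      proc    : E → Proc
      partner : E → E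
      label   : E → Label
      loc     : E → E → Set

    Step : E → E → Set
    Step e e' = (typ e ≡ send × partner e ≡ e') ⊎ loc e e'

    _≺_ : E → E → Set
    _≺_ = Star Step

    letter : E → Letter
    letter e with typ e
    ... | send    = snd (proc e) (proc (partner e)) (label e)
    ... | receive = rcv (proc e) (proc (partner e)) (label e)

  record IsBMSC (M : MSC) : Set where
    open MSC M
    field
      finite        : Σ ℕ λ n → Fin n ↔ E
      partner-inv   : ∀ e → partner (partner e) ≡ e
      partner-kind  : ∀ e → typ (partner e) ≢ typ e
      partner-proc  : ∀ e → proc e ≢ proc (partner e)
      partner-label : ∀ e → label (partner e) ≡ label e
      loc-proc      : ∀ {e e'} → loc e e' → proc e ≡ proc e'
      loc-irrefl    : ∀ {e} → ¬ loc e e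
      loc-trans     : ∀ {e e' e''} → loc e e' → loc e' e'' → loc e e''
      loc-total     : ∀ e e' → proc e ≡ proc e' → e ≢ e' → loc e e' ⊎ loc e' e
      partial-order : ∀ {e e'} → e ≺ e' → e' ≺ e → e ≡ e'
      fifo          : ∀ {e e'} → typ e ≡ send → typ e' ≡ send → loc e e' →
                      proc (partner e) ≡ proc (partner e') →
                      loc (partner e) (partner e')

  BMSC : Set₁
  BMSC = Σ MSC IsBMSC

  Linearization : MSC → List Letter → Set
  Linearization M w =
    Σ (MSC.E M ↔ Fin (length w)) λ π →
      (∀ e → lookup w (Inverse.to π e) ≡ MSC.letter M e) ×
      (∀ e e' → MSC._≺_ M e e' → Inverse.to π e F.≤ Inverse.to π e')

  _·_ : MSC → MSC → MSC
  M₁ · M₂ = record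
    { E       = MSC.E M₁ ⊎ MSC.E M₂
    ; typ     = [ MSC.typ M₁ , MSC.typ M₂ ]′
    ; proc    = [ MSC.proc M₁ , MSC.proc M₂ ]′
    ; partner = map (MSC.partner M₁) (MSC.partner M₂)
    ; label   = [ MSC.label M₁ , MSC.label M₂ ]′
    ; loc     = lc
    }
    where
    lc : MSC.E M₁ ⊎ MSC.E M₂ → MSC.E M₁ ⊎ MSC.E M₂ → Set
    lc (inj₁ a) (inj₁ b) = MSC.loc M₁ a b
    lc (inj₂ a) (inj₂ b) = MSC.loc M₂ a b
    lc (inj₁ a) (inj₂ b) = MSC.proc M₁ a ≡ MSC.proc M₂ b
    lc (inj₂ a) (inj₁ b) = ⊥

  record MSG : Set₁ where
    field
      size  : ℕ
      edge  : Fin size → Fin size → Set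
      s₀ sf : Fin size
      lab   : Fin size → BMSC
      s₀-no-in   : ∀ s → ¬ edge s s₀
      sf-no-out  : ∀ s → ¬ edge sf s
      reach-from : ∀ s → Star edge s₀ s
      reach-to   : ∀ s → Star edge s sf

  module _ (G : MSG) where
    open MSG G

    State : Set
    State = Fin size

    data Path : State → State → Set where
      [_]  : ∀ s → Path s s
      _∷⟨_⟩_ : ∀ s {t u} → edge s t → Path t u → Path s u

    Lpath : ∀ {s t} → Path s t → MSC
    Lpath [ s ]          = proj₁ (lab s)
    Lpath (s ∷⟨ _ ⟩ σ)   = proj₁ (lab s) · Lpath σ

    Lang : List Letter → Set
    Lang w = Σ (Path s₀ sf) λ σ → Linearization (Lpath σ) w

    Initiates : Proc → MSC → Set
    Initiates p M = ∃[ e ] (MSC.proc M e ≡ p × (∀ e' → MSC._≺_ M e' e → e' ≡ e))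

    triggers : State → Proc → Set
    triggers s p = ∃[ t ] ∃[ v ] (edge s t × Σ (Path t v) λ σ → Initiates p (Lpath σ))

    ChoiceNode : State → Set
    ChoiceNode u = ∃[ t ] ∃[ t' ] (t ≢ t' × edge u t × edge u t')

    LocalChoiceNode : State → Set
    LocalChoiceNode u = ∃[ p ] (triggers u p × ∀ q → triggers u q → q ≡ p)

    Resolving : (M : MSC) → (Proc → Set) → MSC.E M → Set
    Resolving M P' e = MSC.typ M e ≡ send ×
      (∀ p → P' p → ∃[ eₚ ] (MSC.proc M eₚ ≡ p × MSC._≺_ M e eₚ))

    HasResolving : MSC → (Proc → Set) → Set
    HasResolving M P' = ∃[ e ] Resolving M P' e

    ControllableChoiceNode : State → Set
    ControllableChoiceNode u =
      (∀ (σ : Path s₀ u) → HasResolving (Lpath σ) (triggers u)) ×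
      (∀ s₁ → edge u s₁ → ∀ (σ : Path s₁ u) → HasResolving (Lpath σ) (triggers u))

  LocalChoice : MSG → Set
  LocalChoice G = ∀ u → ChoiceNode G u → LocalChoiceNode G u

  ControllableChoice : MSG → Set
  ControllableChoice G = ∀ u → ChoiceNode G u →
    LocalChoiceNode G u ⊎ ControllableChoiceNode G u

  SameLanguage : MSG → MSG → Set
  SameLanguage G G' = ∀ w → (Lang G w → Lang G' w) × (Lang G' w → Lang G w)

  InLC : MSG → Set₁
  InLC G = ∃[ G' ] (LocalChoice G' × SameLanguage G G')

  InCC : MSG → Set₁
  InCC G = ∃[ G' ] (ControllableChoice G' × SameLanguage G G')

-- LC ⊆ CC since a local-choice node is allowed in a controllable-choice MSG. For strictness, the MSG G
-- runs a chart A of two crossing messages p → q and q → p and then either B₁ (one message p → q) or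
-- B₂ (two messages q → p). Its only choice node is the initial one, and the first send of A resolves it.
-- An MSG with the language of G has runs for some w₁ ∈ L(A·B₁) and w₂ ∈ L(A·B₂); as these differ in
-- length, the runs branch after a common prefix. Comparing the positions of the prefix events in w₁
-- and in w₂ shows that the prefix fills either no position or exactly the first four of both words,
-- so the branch towards w₁ is initiated by p and the one towards w₂ by q: the branching node is not
-- local-choice.

module Submission where

open import Defs
open import Data.Nat using (ℕ; _≤_)
open import Data.Fin using (Fin)
open import Data.Product using (_×_; ∃-syntax)
open import Relation.Nullary using (¬_)

open import Data.Empty using (⊥; ⊥-elim)
open import Data.Fin as F using (zero; suc)
open import Data.Fin.Patterns using (0F; 1F; 2F; 3F; 4F; 5F; 6F; 7F)
import Data.Fin.Properties as F
open import Data.List using (List; []; _∷_; _++_; foldr; length; lookup)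
import Data.Nat as ℕ
import Data.Nat.Properties as ℕ
open import Data.Product using (_,_; proj₁; proj₂)
open import Data.Sum using (_⊎_; inj₁; inj₂)
import Data.Sum as Sum
open import Data.Sum.Properties using (inj₁-injective; inj₂-injective)
open import Function using (_∘_; id)
open import Function.Bundles using (Inverse; Injection; _↔_; mk↔ₛ′)
open import Function.Properties.Inverse using (↔⇒↣; ↔-refl; ↔-sym; ↔-trans)
open import Relation.Binary.Construct.Closure.ReflexiveTransitive using (ε; _◅_; gmap)
open import Relation.Binary.Definitions using (DecidableEquality; tri<; tri≈; tri>)
open import Relation.Binary.PropositionalEquality
open import Relation.Nullary using (Dec; yes; no; ¬?)
import Relation.Nullary.Decidable as Dec
open import Relation.Nullary.Decidable using (_×-dec_; _⊎-dec_; _→-dec_; True; toWitness; from-yes)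

module Composition (Proc Label : Set) where
  open MSCTheory Proc Label
  open MSC

  procOf : Letter → Proc
  procOf (snd a _ _) = a
  procOf (rcv a _ _) = a

  procOf-letter : ∀ M e → procOf (letter M e) ≡ proc M e
  procOf-letter M e with typ M e
  ... | send    = refl
  ... | receive = refl

  letter≡snd : ∀ M e {a b m} → letter M e ≡ snd a b m →
               typ M e ≡ send × proc M (partner M e) ≡ b
  letter≡snd M e eq with typ M e
  letter≡snd M e refl | send = refl , refl
  letter≡snd M e ()   | receive

  letter-inj₁ : ∀ M₁ M₂ a → letter (M₁ · M₂) (inj₁ a) ≡ letter M₁ a
  letter-inj₁ M₁ M₂ a with typ M₁ a
  ... | send    = refl
  ... | receive = refl

  letter-inj₂ : ∀ M₁ M₂ b → letter (M₁ · M₂) (inj₂ b) ≡ letter M₂ b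
  letter-inj₂ M₁ M₂ b with typ M₂ b
  ... | send    = refl
  ... | receive = refl

  _⋯_ : List MSC → MSC → MSC
  Ms ⋯ S = foldr _·_ S Ms

  PrefixEvent : List MSC → Set
  PrefixEvent []       = ⊥
  PrefixEvent (M ∷ Ms) = E M ⊎ PrefixEvent Ms

  prefix : ∀ Ms S → PrefixEvent Ms → E (Ms ⋯ S)
  prefix (M ∷ Ms) S (inj₁ a) = inj₁ a
  prefix (M ∷ Ms) S (inj₂ x) = inj₂ (prefix Ms S x)

  suffix : ∀ Ms S → E S → E (Ms ⋯ S)
  suffix []       S a = a
  suffix (M ∷ Ms) S a = inj₂ (suffix Ms S a)

  letter-prefix : ∀ Ms S S′ x → letter (Ms ⋯ S) (prefix Ms S x) ≡ letter (Ms ⋯ S′) (prefix Ms S′ x)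
  letter-prefix (M ∷ Ms) S S′ (inj₁ a) = trans (letter-inj₁ M (Ms ⋯ S) a) (sym (letter-inj₁ M (Ms ⋯ S′) a))
  letter-prefix (M ∷ Ms) S S′ (inj₂ x) = begin
    letter (M · (Ms ⋯ S)) (inj₂ (prefix Ms S x))    ≡⟨ letter-inj₂ M (Ms ⋯ S) _ ⟩
    letter (Ms ⋯ S) (prefix Ms S x)                 ≡⟨ letter-prefix Ms S S′ x ⟩
    letter (Ms ⋯ S′) (prefix Ms S′ x)               ≡⟨ sym (letter-inj₂ M (Ms ⋯ S′) _) ⟩
    letter (M · (Ms ⋯ S′)) (inj₂ (prefix Ms S′ x))  ∎
    where open ≡-Reasoning

  partner-prefix : ∀ Ms S x → ∃[ y ] (partner (Ms ⋯ S) (prefix Ms S x) ≡ prefix Ms S y)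
  partner-prefix (M ∷ Ms) S (inj₁ a) = inj₁ (partner M a) , refl
  partner-prefix (M ∷ Ms) S (inj₂ x) with partner-prefix Ms S x
  ... | y , eq = inj₂ y , cong inj₂ eq

  proc-suffix : ∀ Ms S a → proc (Ms ⋯ S) (suffix Ms S a) ≡ proc S a
  proc-suffix []       S a = refl
  proc-suffix (M ∷ Ms) S a = proc-suffix Ms S a

  step-inj₂ : ∀ M₁ M₂ {a b} → Step M₂ a b → Step (M₁ · M₂) (inj₂ a) (inj₂ b)
  step-inj₂ M₁ M₂ (inj₁ (is-send , eq)) = inj₁ (is-send , cong inj₂ eq)
  step-inj₂ M₁ M₂ (inj₂ local)          = inj₂ local

  step-suffix : ∀ Ms S {a b} → Step S a b → Step (Ms ⋯ S) (suffix Ms S a) (suffix Ms S b)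
  step-suffix []       S s = s
  step-suffix (M ∷ Ms) S s = step-inj₂ M (Ms ⋯ S) (step-suffix Ms S s)

  ≺-suffix : ∀ Ms S {a b} → _≺_ S a b → _≺_ (Ms ⋯ S) (suffix Ms S a) (suffix Ms S b)
  ≺-suffix Ms S = gmap (suffix Ms S) (step-suffix Ms S)

  prefix-before-suffix : ∀ Ms S x a → proc (Ms ⋯ S) (prefix Ms S x) ≡ proc (Ms ⋯ S) (suffix Ms S a) →
                         Step (Ms ⋯ S) (prefix Ms S x) (suffix Ms S a)
  prefix-before-suffix (M ∷ Ms) S (inj₁ _) a eq = inj₂ eq
  prefix-before-suffix (M ∷ Ms) S (inj₂ x) a eq = step-inj₂ M (Ms ⋯ S) (prefix-before-suffix Ms S x a eq)

  prefix-or-suffix : ∀ Ms S e → (∃[ x ] prefix Ms S x ≡ e) ⊎ (∃[ a ] suffix Ms S a ≡ e)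
  prefix-or-suffix []       S e        = inj₂ (e , refl)
  prefix-or-suffix (M ∷ Ms) S (inj₁ a) = inj₁ (inj₁ a , refl)
  prefix-or-suffix (M ∷ Ms) S (inj₂ e) with prefix-or-suffix Ms S e
  ... | inj₁ (x , eq) = inj₁ (inj₂ x , cong inj₂ eq)
  ... | inj₂ (a , eq) = inj₂ (a , cong inj₂ eq)

  prefix≢suffix : ∀ Ms S x a → prefix Ms S x ≢ suffix Ms S a
  prefix≢suffix (M ∷ Ms) S (inj₁ _) a ()
  prefix≢suffix (M ∷ Ms) S (inj₂ x) a eq = prefix≢suffix Ms S x a (inj₂-injective eq)

  prefix-injective : ∀ Ms S {x y} → prefix Ms S x ≡ prefix Ms S y → x ≡ y
  prefix-injective (M ∷ Ms) S {inj₁ a} {inj₁ b} eq = cong inj₁ (inj₁-injective eq)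
  prefix-injective (M ∷ Ms) S {inj₁ a} {inj₂ y} ()
  prefix-injective (M ∷ Ms) S {inj₂ x} {inj₁ b} ()
  prefix-injective (M ∷ Ms) S {inj₂ x} {inj₂ y} eq = cong inj₂ (prefix-injective Ms S (inj₂-injective eq))

  suffix-injective : ∀ Ms S {a b} → suffix Ms S a ≡ suffix Ms S b → a ≡ b
  suffix-injective []       S eq = eq
  suffix-injective (M ∷ Ms) S eq = suffix-injective Ms S (inj₂-injective eq)

-- Recursion on u keeps these on Fin (length (u ++ v)); _↑ˡ_ and splitAt would need a cast along length-++.
module ListPositions {A : Set} where
  inl : ∀ (u v : List A) → Fin (length u) → Fin (length (u ++ v))
  inl (_ ∷ u) v zero    = zero
  inl (_ ∷ u) v (suc i) = suc (inl u v i)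

  inr : ∀ (u v : List A) → Fin (length v) → Fin (length (u ++ v))
  inr []      v j = j
  inr (_ ∷ u) v j = suc (inr u v j)

  split : ∀ (u v : List A) → Fin (length (u ++ v)) → Fin (length u) ⊎ Fin (length v)
  split []      v k       = inj₂ k
  split (_ ∷ u) v zero    = inj₁ zero
  split (_ ∷ u) v (suc k) = Sum.map₁ suc (split u v k)

  split-inl : ∀ u v i → split u v (inl u v i) ≡ inj₁ i
  split-inl (_ ∷ u) v zero    = refl
  split-inl (_ ∷ u) v (suc i) = cong (Sum.map₁ suc) (split-inl u v i)

  split-inr : ∀ u v j → split u v (inr u v j) ≡ inj₂ j
  split-inr []      v j = refl
  split-inr (_ ∷ u) v j = cong (Sum.map₁ suc) (split-inr u v j)

  join-split : ∀ u v k → Sum.[ inl u v , inr u v ]′ (split u v k) ≡ k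
  join-split []      v k       = refl
  join-split (_ ∷ u) v zero    = refl
  join-split (_ ∷ u) v (suc k) with split u v k | join-split u v k
  ... | inj₁ i | eq = cong suc eq
  ... | inj₂ j | eq = cong suc eq

  lookup-inl : ∀ u v i → lookup (u ++ v) (inl u v i) ≡ lookup u i
  lookup-inl (_ ∷ u) v zero    = refl
  lookup-inl (_ ∷ u) v (suc i) = lookup-inl u v i

  lookup-inr : ∀ u v j → lookup (u ++ v) (inr u v j) ≡ lookup v j
  lookup-inr []      v j = refl
  lookup-inr (_ ∷ u) v j = lookup-inr u v j

  inl-monotone : ∀ u v {i j} → i F.≤ j → inl u v i F.≤ inl u v j
  inl-monotone (_ ∷ u) v {zero}  {_}     _         = ℕ.z≤n
  inl-monotone (_ ∷ u) v {suc i} {suc j} (ℕ.s≤s i≤j) = ℕ.s≤s (inl-monotone u v i≤j)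

  inr-monotone : ∀ u v {i j} → i F.≤ j → inr u v i F.≤ inr u v j
  inr-monotone []      v i≤j = i≤j
  inr-monotone (_ ∷ u) v i≤j = ℕ.s≤s (inr-monotone u v i≤j)

  inl<inr : ∀ u v i j → inl u v i F.< inr u v j
  inl<inr (_ ∷ u) v zero    j = ℕ.s≤s ℕ.z≤n
  inl<inr (_ ∷ u) v (suc i) j = ℕ.s≤s (inl<inr u v i j)

module Linearizations (Proc Label : Set) where
  open MSCTheory Proc Label
  open Composition Proc Label
  open ListPositions
  open MSC

  linearization-by-steps : ∀ {M w} (π : E M ↔ Fin (length w)) →
    (∀ e → lookup w (Inverse.to π e) ≡ letter M e) →
    (∀ e e′ → Step M e e′ → Inverse.to π e F.≤ Inverse.to π e′) → Linearization M w
  linearization-by-steps {M} π letters steps = π , letters , λ _ _ → monotone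
    where
    monotone : ∀ {e e′} → _≺_ M e e′ → Inverse.to π e F.≤ Inverse.to π e′
    monotone ε        = F.≤-refl
    monotone (s ◅ ss) = F.≤-trans (steps _ _ s) (monotone ss)

  step-inj₁⁻ : ∀ M₁ M₂ {a b} → Step (M₁ · M₂) (inj₁ a) (inj₁ b) → Step M₁ a b
  step-inj₁⁻ M₁ M₂ (inj₁ (is-send , eq)) = inj₁ (is-send , inj₁-injective eq)
  step-inj₁⁻ M₁ M₂ (inj₂ local)          = inj₂ local

  step-inj₂⁻ : ∀ M₁ M₂ {a b} → Step (M₁ · M₂) (inj₂ a) (inj₂ b) → Step M₂ a b
  step-inj₂⁻ M₁ M₂ (inj₁ (is-send , eq)) = inj₁ (is-send , inj₂-injective eq)
  step-inj₂⁻ M₁ M₂ (inj₂ local)          = inj₂ local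

  linearization-· : ∀ {M₁ M₂ u v} → Linearization M₁ u → Linearization M₂ v →
                    Linearization (M₁ · M₂) (u ++ v)
  linearization-· {M₁} {M₂} {u} {v} (π₁ , letters₁ , monotone₁) (π₂ , letters₂ , monotone₂) =
    linearization-by-steps {M = M₁ · M₂} {w = u ++ v} π letters steps
    where
    open Inverse π₁ renaming (to to to₁; from to from₁)
    open Inverse π₂ renaming (to to to₂; from to from₂)

    to : E (M₁ · M₂) → Fin (length (u ++ v))
    to = Sum.[ inl u v ∘ to₁ , inr u v ∘ to₂ ]′

    from : Fin (length (u ++ v)) → E (M₁ · M₂)
    from = Sum.map from₁ from₂ ∘ split u v

    to-from : ∀ k → to (from k) ≡ k
    to-from k = trans (to-map (split u v k)) (join-split u v k)
      where
      to-map : ∀ s → to (Sum.map from₁ from₂ s) ≡ Sum.[ inl u v , inr u v ]′ s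
      to-map (inj₁ i) = cong (inl u v) (Inverse.strictlyInverseˡ π₁ i)
      to-map (inj₂ j) = cong (inr u v) (Inverse.strictlyInverseˡ π₂ j)

    from-to : ∀ e → from (to e) ≡ e
    from-to (inj₁ a) = trans (cong (Sum.map from₁ from₂) (split-inl u v (to₁ a)))
                             (cong inj₁ (Inverse.strictlyInverseʳ π₁ a))
    from-to (inj₂ b) = trans (cong (Sum.map from₁ from₂) (split-inr u v (to₂ b)))
                             (cong inj₂ (Inverse.strictlyInverseʳ π₂ b))

    π : E (M₁ · M₂) ↔ Fin (length (u ++ v))
    π = mk↔ₛ′ to from to-from from-to

    letters : ∀ e → lookup (u ++ v) (to e) ≡ letter (M₁ · M₂) e
    letters (inj₁ a) = trans (lookup-inl u v (to₁ a)) (trans (letters₁ a) (sym (letter-inj₁ M₁ M₂ a)))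
    letters (inj₂ b) = trans (lookup-inr u v (to₂ b)) (trans (letters₂ b) (sym (letter-inj₂ M₁ M₂ b)))

    steps : ∀ e e′ → Step (M₁ · M₂) e e′ → to e F.≤ to e′
    steps (inj₁ a) (inj₁ b) s = inl-monotone u v (monotone₁ a b (step-inj₁⁻ M₁ M₂ s ◅ ε))
    steps (inj₂ a) (inj₂ b) s = inr-monotone u v (monotone₂ a b (step-inj₂⁻ M₁ M₂ s ◅ ε))
    steps (inj₁ a) (inj₂ b) _ = ℕ.<⇒≤ (inl<inr u v (to₁ a) (to₂ b))
    steps (inj₂ a) (inj₁ b) (inj₁ (_ , ()))

  linearization-length : ∀ {M u v} → Linearization M u → Linearization M v → length u ≡ length v
  linearization-length (π , _) (ρ , _) = F.cantor-schröder-bernstein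
    (Injection.injective (↔⇒↣ (↔-trans (↔-sym π) ρ)))
    (Injection.injective (↔⇒↣ (↔-trans (↔-sym ρ) π)))

  module PrefixPositions (Ms : List MSC) (S : MSC) (w : List Letter) (lin : Linearization (Ms ⋯ S) w) where
    private
      M = Ms ⋯ S
      π = proj₁ lin

      position : E M → Fin (length w)
      position = Inverse.to π

      event : Fin (length w) → E M
      event = Inverse.from π

      position-event : ∀ j → position (event j) ≡ j
      position-event = Inverse.strictlyInverseˡ π

      position-injective : ∀ {e e′} → position e ≡ position e′ → e ≡ e′
      position-injective = Injection.injective (↔⇒↣ π)

      letter-position : ∀ e → lookup w (position e) ≡ letter M e
      letter-position = proj₁ (proj₂ lin)

      position-monotone : ∀ {e e′} → _≺_ M e e′ → position e F.≤ position e′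
      position-monotone = proj₂ (proj₂ lin) _ _

      procAt-position : ∀ e → procOf (lookup w (position e)) ≡ proc M e
      procAt-position e = trans (cong procOf (letter-position e)) (procOf-letter M e)

    procAt : Fin (length w) → Proc
    procAt j = procOf (lookup w j)

    at : PrefixEvent Ms → Fin (length w)
    at x = position (prefix Ms S x)

    letter-at : ∀ x → lookup w (at x) ≡ letter M (prefix Ms S x)
    letter-at x = letter-position (prefix Ms S x)

    at-injective : ∀ {x y} → at x ≡ at y → x ≡ y
    at-injective = prefix-injective Ms S ∘ position-injective

    Occupied : Fin (length w) → Set
    Occupied j = ∃[ x ] at x ≡ j

    occupied? : ∀ j → Dec (Occupied j)
    occupied? j with prefix-or-suffix Ms S (event j)
    ... | inj₁ (x , x≡) = yes (x , trans (cong position x≡) (position-event j))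
    ... | inj₂ (a , a≡) = no λ { (x , x-at-j) → prefix≢suffix Ms S x a
            (position-injective (trans x-at-j (trans (sym (position-event j)) (cong position (sym a≡))))) }

    -- Weak composition puts every prefix event before every suffix event of the same process.
    occupied-below : ∀ x j → procAt j ≡ procAt (at x) → j F.≤ at x → Occupied j
    occupied-below x j same-proc j≤x with prefix-or-suffix Ms S (event j)
    ... | inj₁ (y , y≡) = y , trans (cong position y≡) (position-event j)
    ... | inj₂ (a , a≡) = x , F.≤-antisym x≤j j≤x
      where
      a-at-j : position (suffix Ms S a) ≡ j
      a-at-j = trans (cong position a≡) (position-event j)

      same-process : proc M (prefix Ms S x) ≡ proc M (suffix Ms S a)
      same-process = begin
        proc M (prefix Ms S x)               ≡⟨ sym (procAt-position _) ⟩
        procAt (at x)                        ≡⟨ sym same-proc ⟩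
        procAt j                             ≡⟨ cong procAt (sym a-at-j) ⟩
        procAt (position (suffix Ms S a))    ≡⟨ procAt-position _ ⟩
        proc M (suffix Ms S a)               ∎
        where open ≡-Reasoning

      x≤j : at x F.≤ j
      x≤j = subst (at x F.≤_) a-at-j
              (position-monotone (prefix-before-suffix Ms S x a same-process ◅ ε))

    send-partner : ∀ x {a b m} → lookup w (at x) ≡ snd a b m →
                   ∃[ y ] (procAt (at y) ≡ b × at x F.≤ at y)
    send-partner x eq with letter≡snd M (prefix Ms S x) (trans (sym (letter-at x)) eq)
                         | partner-prefix Ms S x
    ... | is-send , partner-on-b | y , partner≡y =
      y , trans (procAt-position _) (trans (cong (proc M) (sym partner≡y)) partner-on-b)
        , position-monotone (inj₁ (is-send , partner≡y) ◅ ε)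

    -- `Initiates G` does not depend on G.
    first-free-initiates : ∀ G j → ¬ Occupied j → (∀ i → i F.< j → Occupied i) →
                           Initiates G (procAt j) S
    first-free-initiates G j free below with prefix-or-suffix Ms S (event j)
    ... | inj₁ (x , x≡) = ⊥-elim (free (x , trans (cong position x≡) (position-event j)))
    ... | inj₂ (a , a≡) = a , proc-a , minimal
      where
      a-at-j : position (suffix Ms S a) ≡ j
      a-at-j = trans (cong position a≡) (position-event j)

      proc-a : proc S a ≡ procAt j
      proc-a = trans (sym (proc-suffix Ms S a))
                     (trans (sym (procAt-position _)) (cong procAt a-at-j))

      minimal : ∀ a′ → _≺_ S a′ a → a′ ≡ a
      minimal a′ a′≺a with position (suffix Ms S a′) F.≟ j
      ... | yes at-j = suffix-injective Ms S (position-injective (trans at-j (sym a-at-j)))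
      ... | no ≢j with below _ (F.≤∧≢⇒< (subst (_ F.≤_) a-at-j
                                          (position-monotone (≺-suffix Ms S a′≺a))) ≢j)
      ...   | x , x-at = ⊥-elim (prefix≢suffix Ms S x a′ (position-injective x-at))

  module CommonPrefix (Ms : List MSC) (S₁ S₂ : MSC) (w₁ w₂ : List Letter)
                      (lin₁ : Linearization (Ms ⋯ S₁) w₁) (lin₂ : Linearization (Ms ⋯ S₂) w₂) where
    module W₁ = PrefixPositions Ms S₁ w₁ lin₁
    module W₂ = PrefixPositions Ms S₂ w₂ lin₂

    same-letter : ∀ x → lookup w₂ (W₂.at x) ≡ lookup w₁ (W₁.at x)
    same-letter x = begin
      lookup w₂ (W₂.at x)                ≡⟨ W₂.letter-at x ⟩
      letter (Ms ⋯ S₂) (prefix Ms S₂ x)  ≡⟨ letter-prefix Ms S₂ S₁ x ⟩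
      letter (Ms ⋯ S₁) (prefix Ms S₁ x)  ≡⟨ sym (W₁.letter-at x) ⟩
      lookup w₁ (W₁.at x)                ∎
      where open ≡-Reasoning

    same-proc : ∀ x → W₂.procAt (W₂.at x) ≡ W₁.procAt (W₁.at x)
    same-proc x = cong procOf (same-letter x)

    letter-once : ∀ {a k} → (∀ i → lookup w₂ i ≡ a → i ≡ k) →
                  ∀ x y → lookup w₁ (W₁.at x) ≡ a → lookup w₁ (W₁.at y) ≡ a → x ≡ y
    letter-once once x y x-a y-a = W₂.at-injective
      (trans (once _ (trans (same-letter x) x-a)) (sym (once _ (trans (same-letter y) y-a))))

    recipient-occupied : ∀ x {a b m} → lookup w₁ (W₁.at x) ≡ snd a b m →
                         ∀ j → W₂.procAt j ≡ b → j F.≤ W₂.at x → W₂.Occupied j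
    recipient-occupied x x-sends j j-on-b j≤x =
      let y , y-on-b , x≤y = W₂.send-partner x (trans (same-letter x) x-sends)
      in W₂.occupied-below y j (trans j-on-b (sym y-on-b)) (F.≤-trans j≤x x≤y)

module Runs (Proc Label : Set) (G : MSCTheory.MSG Proc Label) where
  open MSCTheory Proc Label
  open Composition Proc Label
  open Linearizations Proc Label using (linearization-length)
  open MSG G

  data Split {s} (σ₁ σ₂ : Path G s sf) : Set₁ where
    same   : Lpath G σ₁ ≡ Lpath G σ₂ → Split σ₁ σ₂
    branch : ∀ Ms u {t₁ t₂} → t₁ ≢ t₂ → edge u t₁ → edge u t₂ →
             (ρ₁ : Path G t₁ sf) (ρ₂ : Path G t₂ sf) →
             Lpath G σ₁ ≡ Ms ⋯ Lpath G ρ₁ → Lpath G σ₂ ≡ Ms ⋯ Lpath G ρ₂ → Split σ₁ σ₂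

  split : ∀ {s} (σ₁ σ₂ : Path G s sf) → Split σ₁ σ₂
  split [ _ ]          [ _ ]          = same refl
  split [ _ ]          (_ ∷⟨ e ⟩ _)   = ⊥-elim (sf-no-out _ e)
  split (_ ∷⟨ e ⟩ _)   [ _ ]          = ⊥-elim (sf-no-out _ e)
  split (_∷⟨_⟩_ s {t₁} e₁ σ₁) (_∷⟨_⟩_ .s {t₂} e₂ σ₂) with t₁ F.≟ t₂
  ... | no t₁≢t₂ = branch (proj₁ (lab s) ∷ []) s t₁≢t₂ e₁ e₂ σ₁ σ₂ refl refl
  ... | yes refl with split σ₁ σ₂
  ...   | same eq = same (cong (proj₁ (lab s) ·_) eq)
  ...   | branch Ms u t₁≢t₂ f₁ f₂ ρ₁ ρ₂ eq₁ eq₂ =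
          branch (proj₁ (lab s) ∷ Ms) u t₁≢t₂ f₁ f₂ ρ₁ ρ₂
                 (cong (proj₁ (lab s) ·_) eq₁) (cong (proj₁ (lab s) ·_) eq₂)

  local⇒controllable : LocalChoice G → ControllableChoice G
  local⇒controllable local u choice = inj₁ (local u choice)

  path-to-initial : ∀ {t} → Path G t s₀ → t ≡ s₀
  path-to-initial [ _ ]        = refl
  path-to-initial (_ ∷⟨ e ⟩ σ) with path-to-initial σ
  ... | refl = ⊥-elim (s₀-no-in _ e)

  resolving-initial⇒controllable : HasResolving G (proj₁ (lab s₀)) (triggers G s₀) →
                                   ControllableChoiceNode G s₀
  resolving-initial⇒controllable resolving = from-initial , from-successor
    where
    from-initial : ∀ (σ : Path G s₀ s₀) → HasResolving G (Lpath G σ) (triggers G s₀)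
    from-initial [ _ ]        = resolving
    from-initial (_ ∷⟨ e ⟩ σ) with path-to-initial σ
    ... | refl = ⊥-elim (s₀-no-in _ e)

    from-successor : ∀ s₁ → edge s₀ s₁ → (σ : Path G s₁ s₀) → HasResolving G (Lpath G σ) (triggers G s₀)
    from-successor s₁ e σ with path-to-initial σ
    ... | refl = ⊥-elim (s₀-no-in _ e)

  Separates : Proc → Proc → List Letter → List Letter → Set₁
  Separates p q w₁ w₂ = ∀ Ms S₁ S₂ → Linearization (Ms ⋯ S₁) w₁ → Linearization (Ms ⋯ S₂) w₂ →
                        Initiates G p S₁ × Initiates G q S₂

  local-choice-separated-languages : LocalChoice G → ∀ {p q w₁ w₂} → p ≢ q →
    length w₁ ≢ length w₂ → Separates p q w₁ w₂ → Lang G w₁ → Lang G w₂ → ⊥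
  local-choice-separated-languages lc {p} {q} {w₁} {w₂} p≢q |w₁|≢|w₂| separates (σ₁ , lin₁) (σ₂ , lin₂)
    with split σ₁ σ₂
  ... | same eq =
    |w₁|≢|w₂| (linearization-length {u = w₁} {v = w₂} (subst (λ M → Linearization M w₁) eq lin₁) lin₂)
  ... | branch Ms u t₁≢t₂ e₁ e₂ ρ₁ ρ₂ eq₁ eq₂
    with separates Ms _ _ (subst (λ M → Linearization M w₁) eq₁ lin₁)
                          (subst (λ M → Linearization M w₂) eq₂ lin₂)
  ... | p-initiates , q-initiates with lc u (_ , _ , t₁≢t₂ , e₁ , e₂)
  ... | _ , _ , unique-trigger =
    p≢q (trans (unique-trigger p (_ , _ , e₁ , ρ₁ , p-initiates))
               (sym (unique-trigger q (_ , _ , e₂ , ρ₂ , q-initiates))))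

module Charts (Proc Label : Set) where
  open MSCTheory Proc Label
  open Linearizations Proc Label using (linearization-by-steps)
  open MSC using (E; Step; _≺_; loc; letter)

  record Chart (k : ℕ) : Set where
    field
      kind    : Fin k → Kind
      process : Fin k → Proc
      partner : Fin k → Fin k
      height  : Fin k → ℕ
      ℓ       : Label

    msc : MSC
    msc = record
      { E = Fin k ; typ = kind ; proc = process ; partner = partner ; label = λ _ → ℓ
      ; loc = λ e e′ → process e ≡ process e′ × height e ℕ.< height e′ }

  record IsChart {k} (c : Chart k) : Set where
    open Chart c
    field
      partner-involutive : ∀ e → partner (partner e) ≡ e
      partner-kind       : ∀ e → kind (partner e) ≢ kind e
      partner-process    : ∀ e → process e ≢ process (partner e)
      height-injective   : ∀ e e′ → process e ≡ process e′ → height e ≡ height e′ → e ≡ e′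
      messages-ascend    : ∀ e → kind e ≡ send → height e ℕ.< height (partner e)
      fifo               : ∀ e e′ → kind e ≡ send → kind e′ ≡ send → loc msc e e′ →
                           process (partner e) ≡ process (partner e′) →
                           loc msc (partner e) (partner e′)

  ≺-antisym-by-rank : ∀ M (rank : E M → ℕ) → (∀ {e e′} → Step M e e′ → rank e ℕ.< rank e′) →
                      ∀ {e e′} → _≺_ M e e′ → _≺_ M e′ e → e ≡ e′
  ≺-antisym-by-rank M rank ascends e≺e′ e′≺e with ≡⊎< e≺e′ | ≡⊎< e′≺e
    where
    ≡⊎< : ∀ {e e′} → _≺_ M e e′ → e ≡ e′ ⊎ rank e ℕ.< rank e′
    ≡⊎< ε        = inj₁ refl
    ≡⊎< (s ◅ ss) with ≡⊎< ss
    ... | inj₁ refl = inj₂ (ascends s)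
    ... | inj₂ r<r  = inj₂ (ℕ.<-trans (ascends s) r<r)
  ... | inj₁ e≡e′ | _          = e≡e′
  ... | inj₂ _    | inj₁ e′≡e  = sym e′≡e
  ... | inj₂ r<r′ | inj₂ r′<r  = ⊥-elim (ℕ.<-asym r<r′ r′<r)

  chart-isBMSC : ∀ {k} {c : Chart k} → IsChart c → IsBMSC (Chart.msc c)
  chart-isBMSC {k} {c} laws = record
    { finite        = k , ↔-refl
    ; partner-inv   = partner-involutive
    ; partner-kind  = partner-kind
    ; partner-proc  = partner-process
    ; partner-label = λ _ → refl
    ; loc-proc      = proj₁
    ; loc-irrefl    = λ (_ , h<h) → ℕ.<-irrefl refl h<h
    ; loc-trans     = λ (p₁ , h₁) (p₂ , h₂) → trans p₁ p₂ , ℕ.<-trans h₁ h₂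
    ; loc-total     = total
    ; partial-order = ≺-antisym-by-rank msc height ascends
    ; fifo          = fifo _ _
    }
    where
    open Chart c
    open IsChart laws

    total : ∀ e e′ → process e ≡ process e′ → e ≢ e′ → loc msc e e′ ⊎ loc msc e′ e
    total e e′ same e≢e′ with ℕ.<-cmp (height e) (height e′)
    ... | tri< h<h′ _ _ = inj₁ (same , h<h′)
    ... | tri≈ _ h≡h′ _ = ⊥-elim (e≢e′ (height-injective e e′ same h≡h′))
    ... | tri> _ _ h′<h = inj₂ (sym same , h′<h)

    ascends : ∀ {e e′} → Step msc e e′ → height e ℕ.< height e′
    ascends (inj₁ (is-send , refl)) = messages-ascend _ is-send
    ascends (inj₂ (_ , h<h′))        = h<h′

  module Decide (_≟ₚ_ : DecidableEquality Proc) (_≟ₗ_ : DecidableEquality Label) where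
    _≟ₖ_ : DecidableEquality Kind
    send    ≟ₖ send    = yes refl
    send    ≟ₖ receive = no λ ()
    receive ≟ₖ send    = no λ ()
    receive ≟ₖ receive = yes refl

    _≟Σ_ : DecidableEquality Letter
    snd x y z ≟Σ snd x′ y′ z′ =
      Dec.map′ (λ { (refl , refl , refl) → refl }) (λ { refl → refl , refl , refl })
               (x ≟ₚ x′ ×-dec y ≟ₚ y′ ×-dec z ≟ₗ z′)
    rcv x y z ≟Σ rcv x′ y′ z′ =
      Dec.map′ (λ { (refl , refl , refl) → refl }) (λ { refl → refl , refl , refl })
               (x ≟ₚ x′ ×-dec y ≟ₚ y′ ×-dec z ≟ₗ z′)
    snd _ _ _ ≟Σ rcv _ _ _ = no λ ()
    rcv _ _ _ ≟Σ snd _ _ _ = no λ ()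

    module _ {k} (c : Chart k) where
      open Chart c

      loc? : ∀ e e′ → Dec (MSC.loc msc e e′)
      loc? e e′ = process e ≟ₚ process e′ ×-dec height e ℕ.<? height e′

      step? : ∀ e e′ → Dec (MSC.Step msc e e′)
      step? e e′ = (kind e ≟ₖ send ×-dec partner e F.≟ e′) ⊎-dec loc? e e′

      isChart? : Dec (IsChart c)
      isChart? = Dec.map′
        (λ (inv , kd , pr , inj , asc , ff) → record
          { partner-involutive = inv ; partner-kind = kd ; partner-process = pr
          ; height-injective = inj ; messages-ascend = asc ; fifo = ff })
        (λ laws → let open IsChart laws in
          partner-involutive , partner-kind , partner-process , height-injective , messages-ascend , fifo)
        (   F.all? (λ e → partner (partner e) F.≟ e)
        ×-dec F.all? (λ e → ¬? (kind (partner e) ≟ₖ kind e))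
        ×-dec F.all? (λ e → ¬? (process e ≟ₚ process (partner e)))
        ×-dec F.all? (λ e → F.all? λ e′ →
                process e ≟ₚ process e′ →-dec (height e ℕ.≟ height e′ →-dec e F.≟ e′))
        ×-dec F.all? (λ e → kind e ≟ₖ send →-dec height e ℕ.<? height (partner e))
        ×-dec F.all? (λ e → F.all? λ e′ → kind e ≟ₖ send →-dec (kind e′ ≟ₖ send →-dec
                (loc? e e′ →-dec (process (partner e) ≟ₚ process (partner e′) →-dec
                                  loc? (partner e) (partner e′))))))

      Listing : (u : List Letter) → (Fin k → Fin (length u)) → (Fin (length u) → Fin k) → Set
      Listing u at event = (∀ j → at (event j) ≡ j) × (∀ e → event (at e) ≡ e) ×
                           (∀ e → lookup u (at e) ≡ letter msc e) ×
                           (∀ e e′ → MSC.Step msc e e′ → at e F.≤ at e′)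

      listing? : ∀ u at event → Dec (Listing u at event)
      listing? u at event =
              F.all? (λ j → at (event j) F.≟ j)
        ×-dec F.all? (λ e → event (at e) F.≟ e)
        ×-dec F.all? (λ e → lookup u (at e) ≟Σ letter msc e)
        ×-dec F.all? (λ e → F.all? λ e′ → step? e e′ →-dec at e F.≤? at e′)

      listing⇒linearization : ∀ u at event → {True (listing? u at event)} → Linearization msc u
      listing⇒linearization u at event {listing} =
        let at-event , event-at , letters , steps = toWitness listing
        in linearization-by-steps {M = msc} {w = u} (mk↔ₛ′ at event at-event event-at) letters steps

      bmsc : {True isChart?} → BMSC
      bmsc {laws} = msc , chart-isBMSC (toWitness laws)

module CounterExample (n m : ℕ) where
  Proc  = Fin (ℕ.suc (ℕ.suc n))
  Label = Fin (ℕ.suc m)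

  open MSCTheory Proc Label
  open Composition Proc Label
  open Linearizations Proc Label
  open Charts Proc Label
  open Decide F._≟_ F._≟_
  open Runs Proc Label using (Separates; resolving-initial⇒controllable; local-choice-separated-languages)
  open MSC using (proc; _≺_)

  p q : Proc
  p = 0F
  q = 1F

  ℓ : Label
  ℓ = 0F

  open Chart using (msc; process)

  A : Chart 4
  A = record
    { kind    = λ { 0F → send ; 1F → send ; 2F → receive ; 3F → receive }
    ; process = λ { 0F → p ; 1F → q ; 2F → q ; 3F → p }
    ; partner = λ { 0F → 2F ; 1F → 3F ; 2F → 0F ; 3F → 1F }
    ; height  = λ { 0F → 0 ; 1F → 0 ; 2F → 1 ; 3F → 1 }
    ; ℓ       = ℓ
    }

  B₁ : Chart 2
  B₁ = record
    { kind    = λ { 0F → send ; 1F → receive }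
    ; process = λ { 0F → p ; 1F → q }
    ; partner = λ { 0F → 1F ; 1F → 0F }
    ; height  = λ { 0F → 0 ; 1F → 1 }
    ; ℓ       = ℓ
    }

  B₂ : Chart 4
  B₂ = record
    { kind    = λ { 0F → send ; 1F → receive ; 2F → send ; 3F → receive }
    ; process = λ { 0F → q ; 1F → p ; 2F → q ; 3F → p }
    ; partner = λ { 0F → 1F ; 1F → 0F ; 2F → 3F ; 3F → 2F }
    ; height  = λ { 0F → 0 ; 1F → 1 ; 2F → 1 ; 3F → 2 }
    ; ℓ       = ℓ
    }

  ∅ : Chart 0
  ∅ = record { kind = λ () ; process = λ () ; partner = λ () ; height = λ () ; ℓ = ℓ }

  u₁ u₂ v₁ v₂ : List Letter
  u₁ = snd p q ℓ ∷ snd q p ℓ ∷ rcv q p ℓ ∷ rcv p q ℓ ∷ []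
  u₂ = snd q p ℓ ∷ snd p q ℓ ∷ rcv p q ℓ ∷ rcv q p ℓ ∷ []
  v₁ = snd p q ℓ ∷ rcv q p ℓ ∷ []
  v₂ = snd q p ℓ ∷ rcv p q ℓ ∷ snd q p ℓ ∷ rcv p q ℓ ∷ []

  w₁ w₂ : List Letter
  w₁ = u₁ ++ v₁ ++ []
  w₂ = u₂ ++ v₂ ++ []

  swap-pairs : Fin 4 → Fin 4
  swap-pairs = λ { 0F → 1F ; 1F → 0F ; 2F → 3F ; 3F → 2F }

  data Edge : Fin 4 → Fin 4 → Set where
    a→b₁ : Edge 0F 1F
    a→b₂ : Edge 0F 2F
    b₁→∅ : Edge 1F 3F
    b₂→∅ : Edge 2F 3F

  node : Fin 4 → BMSC
  node 0F = bmsc A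
  node 1F = bmsc B₁
  node 2F = bmsc B₂
  node 3F = bmsc ∅

  G : MSG
  G = record
    { size = 4 ; edge = Edge ; s₀ = 0F ; sf = 3F ; lab = node
    ; s₀-no-in   = λ _ ()
    ; sf-no-out  = λ _ ()
    ; reach-from = λ { 0F → ε ; 1F → a→b₁ ◅ ε ; 2F → a→b₂ ◅ ε ; 3F → a→b₁ ◅ b₁→∅ ◅ ε }
    ; reach-to   = λ { 0F → a→b₁ ◅ b₁→∅ ◅ ε ; 1F → b₁→∅ ◅ ε ; 2F → b₂→∅ ◅ ε ; 3F → ε }
    }

  w₁∈G : Lang G w₁
  w₁∈G = (0F ∷⟨ a→b₁ ⟩ (1F ∷⟨ b₁→∅ ⟩ [ 3F ]))
       , linearization-· (listing⇒linearization A u₁ id id)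
           (linearization-· (listing⇒linearization B₁ v₁ id id)
                            (listing⇒linearization ∅ [] (λ ()) (λ ())))

  w₂∈G : Lang G w₂
  w₂∈G = (0F ∷⟨ a→b₂ ⟩ (2F ∷⟨ b₂→∅ ⟩ [ 3F ]))
       , linearization-· (listing⇒linearization A u₂ swap-pairs swap-pairs)
           (linearization-· (listing⇒linearization B₂ v₂ id id)
                            (listing⇒linearization ∅ [] (λ ()) (λ ())))

  on-p-or-q? : ∀ {k} (c : Chart k) → Dec (∀ e → process c e ≡ p ⊎ process c e ≡ q)
  on-p-or-q? c = F.all? λ e → process c e F.≟ p ⊎-dec process c e F.≟ q

  node-on-p-or-q : ∀ s e → proc (proj₁ (node s)) e ≡ p ⊎ proc (proj₁ (node s)) e ≡ q
  node-on-p-or-q 0F = from-yes (on-p-or-q? A)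
  node-on-p-or-q 1F = from-yes (on-p-or-q? B₁)
  node-on-p-or-q 2F = from-yes (on-p-or-q? B₂)
  node-on-p-or-q 3F = from-yes (on-p-or-q? ∅)

  on-p-or-q : ∀ {t v} (σ : Path G t v) e → proc (Lpath G σ) e ≡ p ⊎ proc (Lpath G σ) e ≡ q
  on-p-or-q [ s ]          e        = node-on-p-or-q s e
  on-p-or-q (s ∷⟨ _ ⟩ σ) (inj₁ e) = node-on-p-or-q s e
  on-p-or-q (s ∷⟨ _ ⟩ σ) (inj₂ e) = on-p-or-q σ e

  -- Every event of G lies on p or q, and the send 0 of A precedes an event on each of them.
  A-resolves : HasResolving G (msc A) (triggers G 0F)
  A-resolves = 0F , refl , reaches
    where
    reaches : ∀ r → triggers G 0F r → ∃[ e ] (proc (msc A) e ≡ r × _≺_ (msc A) 0F e)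
    reaches r (_ , _ , _ , σ , e , e-on-r , _) with on-p-or-q σ e
    ... | inj₁ on-p = 0F , trans (sym on-p) e-on-r , ε
    ... | inj₂ on-q = 2F , trans (sym on-q) e-on-r , inj₁ (refl , refl) ◅ ε

  G-controllable : ControllableChoice G
  G-controllable 0F _                             = inj₂ (resolving-initial⇒controllable G A-resolves)
  G-controllable 1F (_ , _ , t≢t′ , b₁→∅ , b₁→∅) = ⊥-elim (t≢t′ refl)
  G-controllable 2F (_ , _ , t≢t′ , b₂→∅ , b₂→∅) = ⊥-elim (t≢t′ refl)
  G-controllable 3F (_ , _ , _ , () , _)

  w₁-snd-qp-once : ∀ j → lookup w₁ j ≡ snd q p ℓ → j ≡ 1F
  w₁-snd-qp-once = from-yes (F.all? λ j → lookup w₁ j ≟Σ snd q p ℓ →-dec j F.≟ 1F)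

  w₂-snd-pq-once : ∀ j → lookup w₂ j ≡ snd p q ℓ → j ≡ 1F
  w₂-snd-pq-once = from-yes (F.all? λ j → lookup w₂ j ≟Σ snd p q ℓ →-dec j F.≟ 1F)

  w₁-p-late : ∀ j → procOf (lookup w₁ j) ≡ p → 1 ℕ.≤ F.toℕ j → 3 ℕ.≤ F.toℕ j
  w₁-p-late =
    from-yes (F.all? λ j → procOf (lookup w₁ j) F.≟ p →-dec (1 ℕ.≤? F.toℕ j →-dec 3 ℕ.≤? F.toℕ j))

  w₂-q-late : ∀ j → procOf (lookup w₂ j) ≡ q → 1 ℕ.≤ F.toℕ j → 3 ℕ.≤ F.toℕ j
  w₂-q-late =
    from-yes (F.all? λ j → procOf (lookup w₂ j) F.≟ q →-dec (1 ℕ.≤? F.toℕ j →-dec 3 ℕ.≤? F.toℕ j))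

  w₁-q-late : ∀ j → procOf (lookup w₁ j) ≡ q → j ≢ 1F → 2 ℕ.≤ F.toℕ j
  w₁-q-late =
    from-yes (F.all? λ j → procOf (lookup w₁ j) F.≟ q →-dec (¬? (j F.≟ 1F) →-dec 2 ℕ.≤? F.toℕ j))

  w₂-p-late : ∀ j → procOf (lookup w₂ j) ≡ p → j ≢ 1F → 2 ℕ.≤ F.toℕ j
  w₂-p-late =
    from-yes (F.all? λ j → procOf (lookup w₂ j) F.≟ p →-dec (¬? (j F.≟ 1F) →-dec 2 ℕ.≤? F.toℕ j))

  module Separation (Ms : List MSC) (S₁ S₂ : MSC)
                    (lin₁ : Linearization (Ms ⋯ S₁) w₁) (lin₂ : Linearization (Ms ⋯ S₂) w₂) where
    open CommonPrefix Ms S₁ S₂ w₁ w₂ lin₁ lin₂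
    module Swapped = CommonPrefix Ms S₂ S₁ w₂ w₁ lin₂ lin₁

    -- If the prefix holds the first letter of w₁, it holds exactly the first four letters of both words.
    module PrefixStartsW₁ (z₀ : PrefixEvent Ms) (z₀-at₁ : W₁.at z₀ ≡ 0F) where
      z₀-at₂ : W₂.at z₀ ≡ 1F
      z₀-at₂ = w₂-snd-pq-once _ (trans (same-letter z₀) (cong (lookup w₁) z₀-at₁))

      x-occupies : W₂.Occupied 0F
      x-occupies = recipient-occupied z₀ (cong (lookup w₁) z₀-at₁) 0F refl ℕ.z≤n

      x : PrefixEvent Ms
      x = proj₁ x-occupies

      x-at₂ : W₂.at x ≡ 0F
      x-at₂ = proj₂ x-occupies

      x-at₁ : W₁.at x ≡ 1F
      x-at₁ = w₁-snd-qp-once _ (trans (Swapped.same-letter x) (cong (lookup w₂) x-at₂))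

      y-receives : ∃[ y ] (W₂.procAt (W₂.at y) ≡ q × W₂.at z₀ F.≤ W₂.at y)
      y-receives = W₂.send-partner z₀ (cong (lookup w₂) z₀-at₂)

      y′-receives : ∃[ y′ ] (W₁.procAt (W₁.at y′) ≡ p × W₁.at x F.≤ W₁.at y′)
      y′-receives = W₁.send-partner x (cong (lookup w₁) x-at₁)

      y y′ : PrefixEvent Ms
      y  = proj₁ y-receives
      y′ = proj₁ y′-receives

      y-on-q₂ : W₂.procAt (W₂.at y) ≡ q
      y-on-q₂ = proj₁ (proj₂ y-receives)

      y-on-q₁ : W₁.procAt (W₁.at y) ≡ q
      y-on-q₁ = trans (sym (same-proc y)) y-on-q₂

      y′-on-p₁ : W₁.procAt (W₁.at y′) ≡ p
      y′-on-p₁ = proj₁ (proj₂ y′-receives)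

      y′-on-p₂ : W₂.procAt (W₂.at y′) ≡ p
      y′-on-p₂ = trans (same-proc y′) y′-on-p₁

      y-late : 1 ℕ.≤ F.toℕ (W₂.at y)
      y-late = subst (F._≤ W₂.at y) z₀-at₂ (proj₂ (proj₂ y-receives))

      y′-late : 1 ℕ.≤ F.toℕ (W₁.at y′)
      y′-late = subst (F._≤ W₁.at y′) x-at₁ (proj₂ (proj₂ y′-receives))

      y≢x : y ≢ x
      y≢x y≡x with subst (λ j → 1 ℕ.≤ F.toℕ j) (trans (cong W₂.at y≡x) x-at₂) y-late
      ... | ()

      y′≢z₀ : y′ ≢ z₀
      y′≢z₀ y′≡z₀ with subst (λ j → 1 ℕ.≤ F.toℕ j) (trans (cong W₁.at y′≡z₀) z₀-at₁) y′-late
      ... | ()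

      y-at₁≢1 : W₁.at y ≢ 1F
      y-at₁≢1 y-at-1 = y≢x (W₁.at-injective (trans y-at-1 (sym x-at₁)))

      y′-at₂≢1 : W₂.at y′ ≢ 1F
      y′-at₂≢1 y′-at-1 = y′≢z₀ (W₂.at-injective (trans y′-at-1 (sym z₀-at₂)))

      below₁ : ∀ i → F.toℕ i ℕ.< 4 → W₁.Occupied i
      below₁ 0F _ = z₀ , z₀-at₁
      below₁ 1F _ = x , x-at₁
      below₁ 2F _ = W₁.occupied-below y  2F (sym y-on-q₁)  (w₁-q-late _ y-on-q₁ y-at₁≢1)
      below₁ 3F _ = W₁.occupied-below y′ 3F (sym y′-on-p₁) (w₁-p-late _ y′-on-p₁ y′-late)
      below₁ 4F (ℕ.s≤s (ℕ.s≤s (ℕ.s≤s (ℕ.s≤s ()))))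
      below₁ 5F (ℕ.s≤s (ℕ.s≤s (ℕ.s≤s (ℕ.s≤s ()))))

      below₂ : ∀ i → F.toℕ i ℕ.< 4 → W₂.Occupied i
      below₂ 0F _ = x , x-at₂
      below₂ 1F _ = z₀ , z₀-at₂
      below₂ 2F _ = W₂.occupied-below y′ 2F (sym y′-on-p₂) (w₂-p-late _ y′-on-p₂ y′-at₂≢1)
      below₂ 3F _ = W₂.occupied-below y  3F (sym y-on-q₂)  (w₂-q-late _ y-on-q₂ y-late)
      below₂ 4F (ℕ.s≤s (ℕ.s≤s (ℕ.s≤s (ℕ.s≤s ()))))
      below₂ 5F (ℕ.s≤s (ℕ.s≤s (ℕ.s≤s (ℕ.s≤s ()))))
      below₂ 6F (ℕ.s≤s (ℕ.s≤s (ℕ.s≤s (ℕ.s≤s ()))))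
      below₂ 7F (ℕ.s≤s (ℕ.s≤s (ℕ.s≤s (ℕ.s≤s ()))))

      only-z₀-sends-pq : ∀ z → lookup w₁ (W₁.at z) ≡ snd p q ℓ → z ≡ z₀
      only-z₀-sends-pq z z-pq = letter-once w₂-snd-pq-once z z₀ z-pq (cong (lookup w₁) z₀-at₁)

      only-x-sends-qp : ∀ z → lookup w₂ (W₂.at z) ≡ snd q p ℓ → z ≡ x
      only-x-sends-qp z z-qp = Swapped.letter-once w₁-snd-qp-once z x z-qp (cong (lookup w₂) x-at₂)

      free₁ : ¬ W₁.Occupied 4F
      free₁ (z , z-at-4)
        with trans (sym z-at-4) (trans (cong W₁.at (only-z₀-sends-pq z (cong (lookup w₁) z-at-4))) z₀-at₁)
      ... | ()

      free₂ : ¬ W₂.Occupied 4F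
      free₂ (z , z-at-4)
        with trans (sym z-at-4) (trans (cong W₂.at (only-x-sends-qp z (cong (lookup w₂) z-at-4))) x-at₂)
      ... | ()

    initiators : ∀ G → Initiates G p S₁ × Initiates G q S₂
    initiators G with W₁.occupied? 0F
    ... | no free₁ =
      W₁.first-free-initiates G 0F free₁ (λ _ ()) , W₂.first-free-initiates G 0F free₂ (λ _ ())
      where
      free₂ : ¬ W₂.Occupied 0F
      free₂ (x , x-at₂) = free₁ (Swapped.recipient-occupied x (cong (lookup w₂) x-at₂) 0F refl ℕ.z≤n)
    ... | yes (z₀ , z₀-at₁) =
      W₁.first-free-initiates G 4F free₁ below₁ , W₂.first-free-initiates G 4F free₂ below₂
      where open PrefixStartsW₁ z₀ z₀-at₁

  separates : ∀ G → Separates G p q w₁ w₂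
  separates G Ms S₁ S₂ lin₁ lin₂ = Separation.initiators Ms S₁ S₂ lin₁ lin₂ G

  G-in-CC : InCC G
  G-in-CC = G , G-controllable , λ _ → id , id

  G-not-in-LC : ¬ InLC G
  G-not-in-LC (G′ , local , same) = local-choice-separated-languages G′ local (λ ()) (λ ()) (separates G′)
    (proj₁ (same w₁) w₁∈G) (proj₁ (same w₂) w₂∈G)

theorem1 : (np nc : ℕ) → 2 ≤ np → 1 ≤ nc →
    let open MSCTheory (Fin np) (Fin nc) in
    (∀ G → InLC G → InCC G) × (∃[ G ] (InCC G × ¬ InLC G))
theorem1 (ℕ.suc (ℕ.suc n)) (ℕ.suc m) (ℕ.s≤s (ℕ.s≤s ℕ.z≤n)) (ℕ.s≤s ℕ.z≤n) =
  (λ { _ (G′ , local , same) → G′ , local⇒controllable G′ local , same }) , G , G-in-CC , G-not-in-LC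
  where
  open CounterExample n m
  open Runs Proc Label using (local⇒controllable)
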